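{- Let $F$ be a CNF formula on variables $X$ and let $D$ be a correct certified $\mathsf{dec}\text{ - }\mathsf{DNNF}$ on variables $X$ such that every clause of $F(D)$ is also a clause of $F$. Then $F\Rightarrow D$.
   Context: A decision Decomposable Negation Normal Form circuit ($\mathsf{dec}\text{ - }\mathsf{DNNF}$) $D$ on variables $X$ is a directed acyclic graph with exactly one node of indegree $0$ (the source). Nodes of outdegree $0$ (sinks) are labeled $0$ or $1$. Every other node has outdegree $2$ and is either a decision node, labeled with a variable $x\in X$, with one outgoing edge labeled $1$ and the other labeled $0$, or an $\wedge$-node. A variable $x$ is tested in $D$ if some decision node is labeled $x$; $\mathsf{var}(D)$ is the set of tested variables, and for a node $\alpha$, $D(\alpha)$ is the sub-circuit of nodes reachable from $\alpha$. It is required that every $x\in X$ is tested at most once on every source-sink path, and that every $\wedge$-node with successors $\beta,\gamma$ satisfies $\mathsf{var}(D(\beta))\cap\mathsf{var}(D(\gamma))=\emptyset$. For $\tau\in\{0,1\}^X$, a source-sink path $P$ is compatible with $\tau$ if whenever $x$ is tested on $P$, the outgoing edge labeled $\tau(x)$ is in $P$. $\tau$ satisfies $D$ if only $1$-sinks are reached by paths compatible with $\tau$; this is the Boolean function computed by $D$. A certified $\mathsf{dec}\text{ - }\mathsf{DNNF}$ on $X$ is a $\mathsf{dec}\text{ - }\mathsf{DNNF}$ on $X$ in which every $0$-sink $\alpha$ is additionally labeled with a clause $C_\alpha$ over $X$. It is correct if for every $\tau\in\{0,1\}^X$ and every $0$-sink $\alpha$ such that some path from the source to $\alpha$ is compatible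 with $\tau$, we have $C_\alpha(\tau)=0$. $F(D)$ denotes the CNF $\bigwedge_{\alpha} C_\alpha$ over all $0$-sinks $\alpha$ of $D$. For Boolean functions $f,g$ on $X$, $f\Rightarrow g$ means every satisfying assignment of $f$ satisfies $g$. -}

module Defs where

open import Data.Nat using (ℕ; suc)
open import Data.Fin using (Fin; zero; suc; _<_)
open import Data.Bool using (Bool; true; false; _∧_; _∨_; not)
open import Data.List using (List; []; _∷_; foldr)
open import Data.List.Relation.Unary.Any using (Any)
open import Data.List.Relation.Unary.Unique.Propositional using (Unique)
open import Data.List.Relation.Binary.Subset.Propositional using (_⊆_)
open import Data.Sum using (_⊎_)
open import Data.Product using (Σ; ∃; _×_; _,_)
open import Relation.Binary.PropositionalEquality using (_≡_)
open import Relation.Nullary using (¬_)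

-- A literal: a variable together with its polarity (true = positive x,
-- false = negated ¬x).
Literal : ℕ → Set
Literal m = Fin m × Bool

Clause : ℕ → Set
Clause m = List (Literal m)

CNF : ℕ → Set
CNF m = List (Clause m)

Assignment : ℕ → Set
Assignment m = Fin m → Bool

evalLit : ∀ {m} → Literal m → Assignment m → Bool
evalLit (x , true)  τ = τ x
evalLit (x , false) τ = not (τ x)

evalClause : ∀ {m} → Clause m → Assignment m → Bool
evalClause C τ = foldr (λ l b → evalLit l τ ∨ b) false C

evalCNF : ∀ {m} → CNF m → Assignment m → Bool
evalCNF F τ = foldr (λ C b → evalClause C τ ∧ b) true F

data Node (m n : ℕ) : Set where
  sink1 : Node m n
  sink0 : Clause m → Node m n
  dec   : (x : Fin m) (hi lo : Fin n) → Node m n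
  and   : (l r : Fin n) → Node m n

record Circuit (m n : ℕ) : Set where
  field
    node : Fin n → Node m n
open Circuit public

module _ {m n : ℕ} (D : Circuit m n) where

  data EdgeLabel : Set where
    decE : Fin m → Bool → EdgeLabel
    andE : EdgeLabel

  data Edge : Fin n → EdgeLabel → Fin n → Set where
    e1 : ∀ {a x hi lo} → node D a ≡ dec x hi lo → Edge a (decE x true) hi
    e0 : ∀ {a x hi lo} → node D a ≡ dec x hi lo → Edge a (decE x false) lo
    eL : ∀ {a l r} → node D a ≡ and l r → Edge a andE l
    eR : ∀ {a l r} → node D a ≡ and l r → Edge a andE r

  data Path : Fin n → Fin n → Set where
    here : ∀ {a} → Path a a
    step : ∀ {a ℓ b c} → Edge a ℓ b → Path b c → Path a c

  testedOn : ∀ {a b} → Path a b → List (Fin m)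
  testedOn here = []
  testedOn (step {ℓ = decE x _} _ P) = x ∷ testedOn P
  testedOn (step {ℓ = andE} _ P) = testedOn P

  data Compatible (τ : Assignment m) : ∀ {a b} → Path a b → Set where
    here  : ∀ {a} → Compatible τ (here {a})
    stepD : ∀ {a x bit b c} (e : Edge a (decE x bit) b) {P : Path b c} →
            τ x ≡ bit → Compatible τ P → Compatible τ (step e P)
    stepA : ∀ {a b c} (e : Edge a andE b) {P : Path b c} →
            Compatible τ P → Compatible τ (step e P)

  IsSink : Fin n → Set
  IsSink a = (node D a ≡ sink1) ⊎ (Σ (Clause m) λ C → node D a ≡ sink0 C)

  -- x ∈ var(D(α)): some node reachable from α is a decision node on x.
  TestedBelow : Fin n → Fin m → Set
  TestedBelow α x = Σ (Fin n) λ γ → Path α γ × Σ (Fin n) λ hi → Σ (Fin n) λ lo →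
                    node D γ ≡ dec x hi lo

module _ {m k : ℕ} where

  source : Fin (suc k)
  source = zero

  -- D is a dec-DNNF with source node `zero`.
  --  * acyclic: every edge goes to a node of strictly larger index
  --    (a topological numbering of the DAG);
  --  * exactly one node of indegree 0: every node other than `zero` has a
  --    predecessor (zero has none by acyclicity);
  --  * read-once: on every source-sink path each variable is tested at most once;
  --  * decomposability of ∧-nodes.
  record IsDecDNNF (D : Circuit m (suc k)) : Set where
    field
      forward     : ∀ {a ℓ b} → Edge D a ℓ b → a < b
      singleSource : ∀ (b : Fin k) → Σ (Fin (suc k)) λ a → Σ (EdgeLabel D) λ ℓ →
                      Edge D a ℓ (suc b)
      readOnce    : ∀ {b} → IsSink D b → (P : Path D source b) → Unique (testedOn D P)
      decomposable : ∀ {a l r} → node D a ≡ and l r →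
                     ∀ x → ¬ (TestedBelow D l x × TestedBelow D r x)

  Satisfies : Circuit m (suc k) → Assignment m → Set
  Satisfies D τ = ∀ {b} (P : Path D source b) → Compatible D τ P →
                  ∀ C → ¬ (node D b ≡ sink0 C)

  CorrectCertified : Circuit m (suc k) → Set
  CorrectCertified D = ∀ (τ : Assignment m) {α} (C : Clause m) → node D α ≡ sink0 C →
                       (P : Path D source α) → Compatible D τ P → evalClause C τ ≡ false

  -- Every clause of F(D) (the clauses labelling the 0-sinks) is a clause of F.
  -- Clauses are compared as sets of literals.
  ClausesIn : Circuit m (suc k) → CNF m → Set
  ClausesIn D F = ∀ {α} (C : Clause m) → node D α ≡ sink0 C →
                  Any (λ C' → C ⊆ C' × C' ⊆ C) F

-- By correctness, a 0-sink reached by a path compatible with τ carries a clause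
-- that τ falsifies.  That clause is, up to reordering, a clause of F, so τ would
-- falsify F as well.  Hence a model of F reaches no 0-sink.
module Submission where

open import Defs
open import Data.Nat using (ℕ; suc)
open import Data.Bool using (true; false)
open import Data.List using ([]; _∷_)
open import Data.List.Relation.Unary.All using (All; _∷_; []; lookupAny)
open import Data.List.Relation.Unary.Any using (Any; here; there)
open import Data.List.Relation.Binary.Subset.Propositional using (_⊆_)
open import Data.List.Membership.Propositional using (find; lose)
open import Data.Product using (_,_)
open import Function using (case_of_)
open import Relation.Binary.PropositionalEquality using (_≡_; refl; sym; trans)

module _ {m : ℕ} {τ : Assignment m} where

  evalClause≡true⇒Any : ∀ {C : Clause m} → evalClause C τ ≡ true →
                        Any (λ l → evalLit l τ ≡ true) C
  evalClause≡true⇒Any {l ∷ C} eval≡true with evalLit l τ in l≡true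
  ... | true  = here l≡true
  ... | false = there (evalClause≡true⇒Any eval≡true)

  Any⇒evalClause≡true : ∀ {C : Clause m} → Any (λ l → evalLit l τ ≡ true) C →
                        evalClause C τ ≡ true
  Any⇒evalClause≡true (here l≡true) rewrite l≡true = refl
  Any⇒evalClause≡true {l ∷ _} (there any) with evalLit l τ
  ... | true  = refl
  ... | false = Any⇒evalClause≡true any

  evalClause-⊆ : ∀ {C C′ : Clause m} → C ⊆ C′ →
                 evalClause C τ ≡ true → evalClause C′ τ ≡ true
  evalClause-⊆ C⊆C′ C≡true =
    let l , l∈C , l≡true = find (evalClause≡true⇒Any C≡true)
    in Any⇒evalClause≡true (lose (C⊆C′ l∈C) l≡true)

  evalCNF≡true⇒All : ∀ {F : CNF m} → evalCNF F τ ≡ true →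
                     All (λ C → evalClause C τ ≡ true) F
  evalCNF≡true⇒All {[]} _ = []
  evalCNF≡true⇒All {C ∷ F} eval≡true with evalClause C τ in C≡true
  ... | true = C≡true ∷ evalCNF≡true⇒All eval≡true

corollary2 : ∀ {m k : ℕ} (F : CNF m) (D : Circuit m (suc k)) →
             IsDecDNNF D → CorrectCertified D → ClausesIn D F →
             ∀ (τ : Assignment m) → evalCNF F τ ≡ true → Satisfies D τ
corollary2 F D _ correct clausesIn τ F≡true P compatible C α≡sink0 =
  case trans (sym C≡true) C≡false of λ ()
  where
  C≡false : evalClause C τ ≡ false
  C≡false = correct τ C α≡sink0 P compatible

  C≡true : evalClause C τ ≡ true
  C≡true with lookupAny (evalCNF≡true⇒All F≡true) (clausesIn C α≡sink0)
  ... | C′≡true , _ , C′⊆C = evalClause-⊆ C′⊆C C′≡true
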